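{- Let $M=(E,r)$ be a $q$-matroid and $A\le E$. Then $r(A)-r(\mathrm{cyc}(A))=\dim A-\dim\mathrm{cyc}(A)$.
   Context: Let $q$ be a prime power and $E$ an $n$-dimensional $\mathbb{F}_q$-vector space. A $q$-matroid $(E,r)$ is a function $r$ from subspaces of $E$ to $\mathbb{Z}$ with (R1) $0\le r(A)\le\dim A$, (R2) $r(A)\le r(B)$ if $A\le B$, (R3) $r(A+B)+r(A\cap B)\le r(A)+r(B)$. For $A\le E$, $\mathrm{cyc}(A)=\sum x$ over all $1$-dimensional subspaces $x\le A$ such that $r(B+x)=r(B)$ for every subspace $B\le A$ of codimension $1$ in $A$ (zero space if there is none). -}

module Defs where

open import Level using (0ℓ) renaming (suc to lsuc)
open import Data.Nat using (ℕ; zero; suc)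
open import Data.Fin using (Fin; zero; suc)
open import Data.Integer as ℤ using (ℤ; +_)
open import Data.List using (List)
open import Data.List.Relation.Unary.Any using (Any)
open import Data.Product using (Σ; ∃; _×_; _,_; proj₁; proj₂)
open import Relation.Nullary using (¬_)
open import Relation.Unary using (Pred)
open import Relation.Binary.PropositionalEquality using (_≡_)
open import Algebra.Bundles using (CommutativeRing)
import Algebra.Properties.CommutativeSemigroup as CSProps

-- Its order q = number of distinct elements is then automatically a prime power.
record FiniteField : Set₁ where
  field
    commRing : CommutativeRing 0ℓ 0ℓ
  open CommutativeRing commRing public
  field
    0≉1      : ¬ (0# ≈ 1#)
    inverse  : ∀ x → ¬ (x ≈ 0#) → ∃ λ y → (x * y) ≈ 1#
    elements : List Carrier
    complete : ∀ x → Any (x ≈_) elements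

module Space (F : FiniteField) (n : ℕ) where
  open FiniteField F hiding (zero)
  open CSProps +-commutativeSemigroup using (interchange)

  V : Set
  V = Fin n → Carrier

  infix 4 _≈v_
  _≈v_ : V → V → Set
  u ≈v v = ∀ i → u i ≈ v i

  0v : V
  0v _ = 0#

  infixl 6 _+v_
  _+v_ : V → V → V
  (u +v v) i = u i + v i

  infixr 7 _·_
  _·_ : Carrier → V → V
  (c · v) i = c * v i

  record Subspace : Set₁ where
    field
      _∈ₛ   : Pred V 0ℓ
      resp  : ∀ {u v} → u ≈v v → u ∈ₛ → v ∈ₛ
      0∈    : 0v ∈ₛ
      +∈    : ∀ {u v} → u ∈ₛ → v ∈ₛ → (u +v v) ∈ₛ
      ·∈    : ∀ c {v} → v ∈ₛ → (c · v) ∈ₛ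
  open Subspace public

  infix 4 _∈_
  _∈_ : V → Subspace → Set
  v ∈ A = _∈ₛ A v

  infix 4 _≤_ _≐_
  _≤_ : Subspace → Subspace → Set
  A ≤ B = ∀ {v} → v ∈ A → v ∈ B

  _≐_ : Subspace → Subspace → Set
  A ≐ B = (A ≤ B) × (B ≤ A)

  infixl 6 _⊕_
  _⊕_ : Subspace → Subspace → Subspace
  A ⊕ B = record
    { _∈ₛ  = λ v → Σ V λ a → Σ V λ b → (a ∈ A) × (b ∈ B) × (v ≈v a +v b)
    ; resp = λ { u≈v (a , b , a∈ , b∈ , e) → a , b , a∈ , b∈ , (λ i → trans (sym (u≈v i)) (e i)) }
    ; 0∈   = 0v , 0v , 0∈ A , 0∈ B , (λ i → sym (+-identityʳ 0#))
    ; +∈   = λ { (a , b , a∈ , b∈ , e) (a' , b' , a∈' , b∈' , e') →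
               a +v a' , b +v b' , +∈ A a∈ a∈' , +∈ B b∈ b∈' ,
               (λ i → trans (+-cong (e i) (e' i)) (interchange (a i) (b i) (a' i) (b' i))) }
    ; ·∈   = λ { c (a , b , a∈ , b∈ , e) →
               c · a , c · b , ·∈ A c a∈ , ·∈ B c b∈ ,
               (λ i → trans (*-congˡ (e i)) (distribˡ c (a i) (b i))) }
    }

  infixl 7 _∩_
  _∩_ : Subspace → Subspace → Subspace
  A ∩ B = record
    { _∈ₛ  = λ v → (v ∈ A) × (v ∈ B)
    ; resp = λ e (p , q) → resp A e p , resp B e q
    ; 0∈   = 0∈ A , 0∈ B
    ; +∈   = λ (p , q) (p' , q') → +∈ A p p' , +∈ B q q'
    ; ·∈   = λ c (p , q) → ·∈ A c p , ·∈ B c q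
    }

  lincomb : ∀ {d} → (Fin d → Carrier) → (Fin d → V) → V
  lincomb {zero}  c b = 0v
  lincomb {suc d} c b = (c zero · b zero) +v lincomb (λ i → c (suc i)) (λ i → b (suc i))

  vsum : ∀ {k} → (Fin k → V) → V
  vsum {zero}  w = 0v
  vsum {suc k} w = w zero +v vsum (λ i → w (suc i))

  record IsBasis (A : Subspace) {d : ℕ} (b : Fin d → V) : Set where
    field
      inA      : ∀ i → b i ∈ A
      linIndep : ∀ (c : Fin d → Carrier) → lincomb c b ≈v 0v → ∀ i → c i ≈ 0#
      spans    : ∀ {v} → v ∈ A → Σ (Fin d → Carrier) λ c → v ≈v lincomb c b

  HasDim : Subspace → ℕ → Set
  HasDim A d = Σ (Fin d → V) λ b → IsBasis A b

  IsHyperplaneOf : Subspace → Subspace → Set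
  IsHyperplaneOf B A = (B ≤ A) × Σ ℕ λ d → HasDim A (suc d) × HasDim B d

  record QMatroid : Set₁ where
    field
      r    : Subspace → ℤ
      -- r is a function of the subspace (as a set of vectors)
      r-ext : ∀ {A B} → A ≐ B → r A ≡ r B
      R1-lower : ∀ A → + 0 ℤ.≤ r A
      R1-upper : ∀ A d → HasDim A d → r A ℤ.≤ + d
      R2 : ∀ {A B} → A ≤ B → r A ℤ.≤ r B
      R3 : ∀ A B → (r (A ⊕ B) ℤ.+ r (A ∩ B)) ℤ.≤ (r A ℤ.+ r B)

  module _ (M : QMatroid) where
    open QMatroid M

    IsCycLine : Subspace → Subspace → Set₁
    IsCycLine A x = HasDim x 1 × (x ≤ A) ×
                    (∀ B → IsHyperplaneOf B A → r (B ⊕ x) ≡ r B)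

    -- C = cyc(A): C is the sum of all such 1-dimensional subspaces x
    -- (the zero space if there is none); i.e. v ∈ C iff v is a finite sum of
    -- vectors each lying in such an x.
    IsCyc : Subspace → Subspace → Set₁
    IsCyc A C =
      (∀ {v} → v ∈ C →
        Σ ℕ λ k → Σ (Fin k → Subspace) λ xs → Σ (Fin k → V) λ w →
          (∀ i → IsCycLine A (xs i)) × (∀ i → w i ∈ xs i) × (v ≈v vsum w))
      ×
      (∀ {v} →
        (Σ ℕ λ k → Σ (Fin k → Subspace) λ xs → Σ (Fin k → V) λ w →
          (∀ i → IsCycLine A (xs i)) × (∀ i → w i ∈ xs i) × (v ≈v vsum w))
        → v ∈ C)

-- Write C = cyc(A). Extending a basis of C to one of A, each new vector raises the rank by at most
-- one, so r(A) − r(C) ≤ dim A − dim C. Conversely dim X − dim C ≤ r(X) − r(C) for C ≤ X ≤ A, by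
-- induction on dim X: if X ≠ C, pick a basis vector v of X outside C. The line ⟨v⟩ is not among
-- the lines summing to C, so some hyperplane B of A has r(B + ⟨v⟩) ≠ r(B); then v ∉ B,
-- B + ⟨v⟩ = A and r(B) < r(A). Every line x in the sum defining C lies in B, since otherwise
-- r(B + x) = r(A) ≠ r(B); hence C ≤ B. Now B ∩ X is a hyperplane of X containing C with
-- B + X = A, so submodularity gives r(B ∩ X) < r(X), and the induction hypothesis for B ∩ X
-- yields the claim for X.
--
-- The goal is a decidable equation between integers, so the argument may run in the
-- double-negation monad. There we may assume decidable equality on the finite field and
-- excluded middle for membership of a vector in a subspace.
module Submission where

open import Defs
import Algebra.Properties.Semiring.Sum as SemiringSum
open import Data.Fin using (Fin; zero; suc; punchIn)
open import Data.Fin.Properties using (all?; ¬∀⟶∃¬)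
open import Data.Integer using (_-_; +_)
import Data.Integer as ℤ
import Data.Integer.Properties as ℤ
open import Data.List using (lookup)
open import Data.List.Relation.Unary.Any using (index)
open import Data.List.Relation.Unary.Any.Properties using (lookup-index)
open import Data.Nat as ℕ using (ℕ; zero; suc)
import Data.Nat.Properties as ℕ
open import Data.Product using (Σ; ∃; _×_; _,_; proj₁; proj₂)
open import Data.Sum using (_⊎_; inj₁; inj₂)
open import Data.Vec.Functional using (_∷_; insertAt)
open import Data.Vec.Functional.Properties using (insertAt-lookup; insertAt-punchIn)
open import Effect.Monad using (RawMonad)
open import Function using (_∘_)
open import Level using (0ℓ)
open import Relation.Binary.Definitions using (Decidable)
open import Relation.Binary.PropositionalEquality as ≡ using (_≡_)
open import Relation.Nullary using (¬_; Dec; yes; no)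
open import Relation.Nullary.Decidable using (map′; ¬¬-excluded-middle; decidable-stable)
open import Relation.Nullary.Negation using (¬¬-map; ¬¬-Monad; contradiction)

¬¬-Π : ∀ {p n} {P : Fin n → Set p} → (∀ i → ¬ ¬ P i) → ¬ ¬ (∀ i → P i)
¬¬-Π {n = zero}  _ k = k λ ()
¬¬-Π {n = suc n} h k = h zero λ p₀ → ¬¬-Π (h ∘ suc) λ ps → k λ { zero → p₀ ; (suc i) → ps i }

¬¬-∀⊎∃¬ : ∀ {n} (P : Fin n → Set) → ¬ ¬ ((∀ i → P i) ⊎ ∃ λ i → ¬ P i)
¬¬-∀⊎∃¬ P = ¬¬-map decide (¬¬-Π λ _ → ¬¬-excluded-middle)
  where
  decide : (∀ i → Dec (P i)) → (∀ i → P i) ⊎ ∃ λ i → ¬ P i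
  decide P? with all? P?
  ... | yes ∀P = inj₁ λ i → ∀P i
  ... | no ¬∀P = inj₂ (¬∀⟶∃¬ _ P P? ¬∀P)

¬¬-≈-decidable : (F : FiniteField) → ¬ ¬ Decidable (FiniteField._≈_ F)
¬¬-≈-decidable F = ¬¬-map decide (¬¬-Π λ _ → ¬¬-Π λ _ → ¬¬-excluded-middle)
  where
  open FiniteField F
  decide : (∀ i j → Dec (lookup elements i ≈ lookup elements j)) → Decidable _≈_
  decide d x y = map′ (λ e → trans x≈ (trans e (sym y≈))) (λ e → trans (sym x≈) (trans e y≈))
                      (d (index (complete x)) (index (complete y)))
    where
    x≈ = lookup-index (complete x)
    y≈ = lookup-index (complete y)

module IntegerArithmetic where
  open import Data.Integer using (_+_; -_; _≤_; _<_)
  open import Data.Integer.Properties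
    using (+-comm; +-assoc; +-monoˡ-≤; +-monoʳ-≤; i<j⇒suc[i]≤j; suc[i]≤j⇒i<j; module ≤-Reasoning)
  open import Data.Integer.Solver using (module +-*-Solver)
  open +-*-Solver using (solve; _:=_; _:+_; _:-_; con)

  +-cancelʳ-≤ : ∀ {i j} k → i + k ≤ j + k → i ≤ j
  +-cancelʳ-≤ {i} {j} k i+k≤j+k = ≡.subst₂ _≤_ (cancel i) (cancel j) (+-monoˡ-≤ (- k) i+k≤j+k)
    where
    cancel : ∀ x → x + k - k ≡ x
    cancel x = solve 2 (λ x k → x :+ k :- k := x) ≡.refl x k

  +1-cancel-≤ : ∀ i j k l → i + (+ 1 + j) ≤ (+ 1 + k) + l → i + j ≤ k + l
  +1-cancel-≤ i j k l h = +-cancelʳ-≤ (+ 1) (≡.subst₂ _≤_ lhs rhs h)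
    where
    lhs : i + (+ 1 + j) ≡ i + j + + 1
    lhs = solve 2 (λ i j → i :+ (con (+ 1) :+ j) := i :+ j :+ con (+ 1)) ≡.refl i j
    rhs : (+ 1 + k) + l ≡ k + l + + 1
    rhs = solve 2 (λ k l → (con (+ 1) :+ k) :+ l := k :+ l :+ con (+ 1)) ≡.refl k l

  i+l≡k+j⇒i-k≡j-l : ∀ i j k l → i + l ≡ k + j → i - k ≡ j - l
  i+l≡k+j⇒i-k≡j-l i j k l eq = begin
    i - k             ≡⟨ solve 3 (λ i k l → i :- k := (i :+ l) :- (k :+ l)) ≡.refl i k l ⟩
    (i + l) - (k + l) ≡⟨ ≡.cong (_- (k + l)) eq ⟩
    (k + j) - (k + l) ≡⟨ solve 3 (λ j k l → (k :+ j) :- (k :+ l) := j :- l) ≡.refl j k l ⟩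
    j - l             ∎
    where open ≡.≡-Reasoning

  i+j≤k+l∧k<i⇒j<l : ∀ {i j k l} → i + j ≤ k + l → k < i → j < l
  i+j≤k+l∧k<i⇒j<l {i} {j} {k} {l} i+j≤k+l k<i = suc[i]≤j⇒i<j (+-cancelʳ-≤ k (begin
    (+ 1 + j) + k ≡⟨ solve 2 (λ j k → (con (+ 1) :+ j) :+ k := (con (+ 1) :+ k) :+ j) ≡.refl j k ⟩
    (+ 1 + k) + j ≤⟨ +-monoˡ-≤ j (i<j⇒suc[i]≤j k<i) ⟩
    i + j         ≤⟨ i+j≤k+l ⟩
    k + l         ≡⟨ +-comm k l ⟩
    l + k         ∎))
    where open ≤-Reasoning

  i+m≤j+d∧j<k⇒i+suc[m]≤k+d : ∀ {i j k} m d → i + + m ≤ j + + d → j < k → i + + suc m ≤ k + + d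
  i+m≤j+d∧j<k⇒i+suc[m]≤k+d {i} {j} {k} m d i+m≤j+d j<k = begin
    i + + suc m     ≡⟨ solve 2 (λ i m → i :+ (con (+ 1) :+ m) := con (+ 1) :+ (i :+ m)) ≡.refl i (+ m) ⟩
    + 1 + (i + + m) ≤⟨ +-monoʳ-≤ (+ 1) i+m≤j+d ⟩
    + 1 + (j + + d) ≡⟨ +-assoc (+ 1) j (+ d) ⟨
    (+ 1 + j) + + d ≤⟨ +-monoˡ-≤ (+ d) (i<j⇒suc[i]≤j j<k) ⟩
    k + + d         ∎
    where open ≤-Reasoning

module LinearAlgebra (F : FiniteField) (n : ℕ) (_≟_ : Decidable (FiniteField._≈_ F)) where
  open FiniteField F hiding (zero)
  open Space F n
  open IsBasis using (inA; linIndep; spans)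
  open SemiringSum semiring using (sum; sum-cong-≋; ∑-distrib-+; *-distribʳ-sum; sum-remove)
  open import Algebra.Properties.Ring ring using (-1*x≈-x; -‿distribˡ-*)
  open import Algebra.Properties.Group +-group using (inverseˡ-unique; x∙y⁻¹≈ε⇒x≈y)
  open import Algebra.Properties.AbelianGroup +-abelianGroup using (xyx⁻¹≈y; ⁻¹-∙-comm)
  open import Algebra.Properties.CommutativeSemigroup +-commutativeSemigroup using (interchange)
  open import Relation.Binary.Reasoning.Setoid setoid

  Independent : ∀ {d} → (Fin d → V) → Set
  Independent b = ∀ c → lincomb c b ≈v 0v → ∀ i → c i ≈ 0#

  lincomb-pointwise : ∀ {d} (c : Fin d → Carrier) (b : Fin d → V) t →
                      lincomb c b t ≡ sum (λ k → c k * b k t)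
  lincomb-pointwise {zero}  c b t = ≡.refl
  lincomb-pointwise {suc d} c b t =
    ≡.cong (λ s → c zero * b zero t + s) (lincomb-pointwise (c ∘ suc) (b ∘ suc) t)

  lincomb-cong : ∀ {d} {c c' : Fin d → Carrier} {b b' : Fin d → V} →
                 (∀ k → c k ≈ c' k) → (∀ k → b k ≈v b' k) → lincomb c b ≈v lincomb c' b'
  lincomb-cong {c = c} {c'} {b} {b'} c≈c' b≈b' t = begin
    lincomb c b t             ≡⟨ lincomb-pointwise c b t ⟩
    sum (λ k → c k * b k t)   ≈⟨ sum-cong-≋ (λ k → *-cong (c≈c' k) (b≈b' k t)) ⟩
    sum (λ k → c' k * b' k t) ≡⟨ lincomb-pointwise c' b' t ⟨
    lincomb c' b' t           ∎

  lincomb-+ᶜ : ∀ {d} (c c' : Fin d → Carrier) (b : Fin d → V) →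
               lincomb (λ k → c k + c' k) b ≈v lincomb c b +v lincomb c' b
  lincomb-+ᶜ c c' b t = begin
    lincomb (λ k → c k + c' k) b t
      ≡⟨ lincomb-pointwise _ b t ⟩
    sum (λ k → (c k + c' k) * b k t)
      ≈⟨ sum-cong-≋ (λ k → distribʳ (b k t) (c k) (c' k)) ⟩
    sum (λ k → c k * b k t + c' k * b k t)
      ≈⟨ ∑-distrib-+ (λ k → c k * b k t) (λ k → c' k * b k t) ⟩
    sum (λ k → c k * b k t) + sum (λ k → c' k * b k t)
      ≡⟨ ≡.cong₂ _+_ (lincomb-pointwise c b t) (lincomb-pointwise c' b t) ⟨
    lincomb c b t + lincomb c' b t
      ∎

  lincomb-*ᶜ : ∀ {d} (s : Carrier) (c : Fin d → Carrier) (b : Fin d → V) →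
               lincomb (λ k → s * c k) b ≈v s · lincomb c b
  lincomb-*ᶜ {zero}  s c b t = sym (zeroʳ s)
  lincomb-*ᶜ {suc d} s c b t = begin
    s * c zero * b zero t + lincomb (λ k → s * c (suc k)) (b ∘ suc) t
      ≈⟨ +-cong (*-assoc s (c zero) (b zero t)) (lincomb-*ᶜ s (c ∘ suc) (b ∘ suc) t) ⟩
    s * (c zero * b zero t) + s * lincomb (c ∘ suc) (b ∘ suc) t
      ≈⟨ distribˡ s _ _ ⟨
    s * lincomb c b t
      ∎

  lincomb-zeroᶜ : ∀ {d} (c : Fin d → Carrier) (b : Fin d → V) → (∀ k → c k ≈ 0#) → lincomb c b ≈v 0v
  lincomb-zeroᶜ {zero}  c b c≈0 t = refl
  lincomb-zeroᶜ {suc d} c b c≈0 t = begin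
    c zero * b zero t + lincomb (c ∘ suc) (b ∘ suc) t
      ≈⟨ +-cong (trans (*-congʳ (c≈0 zero)) (zeroˡ _)) (lincomb-zeroᶜ (c ∘ suc) (b ∘ suc) (c≈0 ∘ suc) t) ⟩
    0# + 0#
      ≈⟨ +-identityˡ 0# ⟩
    0#
      ∎

  lincomb-zeroᵛ : ∀ {d} (c : Fin d → Carrier) (b : Fin d → V) → (∀ k → b k ≈v 0v) → lincomb c b ≈v 0v
  lincomb-zeroᵛ {zero}  c b b≈0 t = refl
  lincomb-zeroᵛ {suc d} c b b≈0 t = begin
    c zero * b zero t + lincomb (c ∘ suc) (b ∘ suc) t
      ≈⟨ +-cong (trans (*-congˡ (b≈0 zero t)) (zeroʳ _)) (lincomb-zeroᵛ (c ∘ suc) (b ∘ suc) (b≈0 ∘ suc) t) ⟩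
    0# + 0#
      ≈⟨ +-identityˡ 0# ⟩
    0#
      ∎

  lincomb-head-zero : ∀ {d} (c : Fin (suc d) → Carrier) (b : Fin (suc d) → V) →
                      c zero ≈ 0# → lincomb c b ≈v lincomb (c ∘ suc) (b ∘ suc)
  lincomb-head-zero c b c₀≈0 t = begin
    c zero * b zero t + lincomb (c ∘ suc) (b ∘ suc) t ≈⟨ +-congʳ (trans (*-congʳ c₀≈0) (zeroˡ _)) ⟩
    0# + lincomb (c ∘ suc) (b ∘ suc) t                ≈⟨ +-identityˡ _ ⟩
    lincomb (c ∘ suc) (b ∘ suc) t                     ∎

  lincomb-removeAt : ∀ {d} (i : Fin (suc d)) (c : Fin (suc d) → Carrier) (b : Fin (suc d) → V) →
                     lincomb c b ≈v c i · b i +v lincomb (c ∘ punchIn i) (b ∘ punchIn i)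
  lincomb-removeAt i c b t = begin
    lincomb c b t
      ≡⟨ lincomb-pointwise c b t ⟩
    sum (λ k → c k * b k t)
      ≈⟨ sum-remove {i = i} (λ k → c k * b k t) ⟩
    c i * b i t + sum (λ k → c (punchIn i k) * b (punchIn i k) t)
      ≡⟨ ≡.cong (λ s → c i * b i t + s) (lincomb-pointwise (c ∘ punchIn i) (b ∘ punchIn i) t) ⟨
    c i * b i t + lincomb (c ∘ punchIn i) (b ∘ punchIn i) t
      ∎

  lincomb-shift : ∀ {d} (i : Fin (suc d)) (μ c : Fin d → Carrier) (b : Fin (suc d) → V) →
                  lincomb c (λ k → b (punchIn i k) +v μ k · b i)
                    ≈v sum (λ k → c k * μ k) · b i +v lincomb c (b ∘ punchIn i)
  lincomb-shift i μ c b t = begin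
    lincomb c (λ k → b (punchIn i k) +v μ k · b i) t
      ≡⟨ lincomb-pointwise c _ t ⟩
    sum (λ k → c k * (b (punchIn i k) t + μ k * b i t))
      ≈⟨ sum-cong-≋ (λ k → distribˡ (c k) _ _) ⟩
    sum (λ k → c k * b (punchIn i k) t + c k * (μ k * b i t))
      ≈⟨ ∑-distrib-+ (λ k → c k * b (punchIn i k) t) _ ⟩
    sum (λ k → c k * b (punchIn i k) t) + sum (λ k → c k * (μ k * b i t))
      ≈⟨ +-comm _ _ ⟩
    sum (λ k → c k * (μ k * b i t)) + sum (λ k → c k * b (punchIn i k) t)
      ≈⟨ +-cong (sum-cong-≋ (λ k → *-assoc (c k) (μ k) (b i t)))
                (reflexive (lincomb-pointwise c (b ∘ punchIn i) t)) ⟨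
    sum (λ k → c k * μ k * b i t) + lincomb c (b ∘ punchIn i) t
      ≈⟨ +-congʳ (*-distribʳ-sum (b i t) (λ k → c k * μ k)) ⟨
    sum (λ k → c k * μ k) * b i t + lincomb c (b ∘ punchIn i) t
      ∎

  lincomb-∈ : ∀ (S : Subspace) {d} (c : Fin d → Carrier) {b : Fin d → V} → (∀ k → b k ∈ S) → lincomb c b ∈ S
  lincomb-∈ S {zero}  c b∈S = 0∈ S
  lincomb-∈ S {suc d} c b∈S = +∈ S (·∈ S (c zero) (b∈S zero)) (lincomb-∈ S (c ∘ suc) (b∈S ∘ suc))

  vsum-∈ : ∀ (S : Subspace) {k} {w : Fin k → V} → (∀ i → w i ∈ S) → vsum w ∈ S
  vsum-∈ S {zero}  w∈S = 0∈ S
  vsum-∈ S {suc k} w∈S = +∈ S (w∈S zero) (vsum-∈ S (w∈S ∘ suc))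

  ⊕-≤ : ∀ {X Y Z : Subspace} → X ≤ Z → Y ≤ Z → (X ⊕ Y) ≤ Z
  ⊕-≤ {Z = Z} X≤Z Y≤Z (x , y , x∈X , y∈Y , v≈) = resp Z (λ t → sym (v≈ t)) (+∈ Z (X≤Z x∈X) (Y≤Z y∈Y))

  ∉⇒≉0 : ∀ {S : Subspace} {u} → ¬ (u ∈ S) → ¬ (u ≈v 0v)
  ∉⇒≉0 {S} u∉S u≈0 = u∉S (resp S (λ t → sym (u≈0 t)) (0∈ S))

  ·-∈⇒≈0 : ∀ (S : Subspace) {κ v} → ¬ (v ∈ S) → (κ · v) ∈ S → κ ≈ 0#
  ·-∈⇒≈0 S {κ} {v} v∉S κv∈S with κ ≟ 0#
  ... | yes κ≈0 = κ≈0
  ... | no  κ≉0 with inverse κ κ≉0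
  ...   | y , κy≈1 = contradiction (resp S y·κv≈v (·∈ S y κv∈S)) v∉S
    where
    y·κv≈v : y · (κ · v) ≈v v
    y·κv≈v t = begin
      y * (κ * v t) ≈⟨ *-assoc y κ (v t) ⟨
      y * κ * v t   ≈⟨ *-congʳ (trans (*-comm y κ) κy≈1) ⟩
      1# * v t      ≈⟨ *-identityˡ (v t) ⟩
      v t           ∎

  span : ∀ {d} → (Fin d → V) → Subspace
  span {d} b = record
    { _∈ₛ  = λ v → Σ (Fin d → Carrier) λ c → v ≈v lincomb c b
    ; resp = λ u≈v (c , u≈) → c , λ t → trans (sym (u≈v t)) (u≈ t)
    ; 0∈   = (λ _ → 0#) , λ t → sym (lincomb-zeroᶜ _ b (λ _ → refl) t)
    ; +∈   = λ (c , u≈) (c' , v≈) →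
               (λ k → c k + c' k) , λ t → trans (+-cong (u≈ t) (v≈ t)) (sym (lincomb-+ᶜ c c' b t))
    ; ·∈   = λ s (c , v≈) → (λ k → s * c k) , λ t → trans (*-congˡ (v≈ t)) (sym (lincomb-*ᶜ s c b t))
    }

  span-≤ : ∀ {d} {a : Fin d → V} (S : Subspace) → (∀ k → a k ∈ S) → span a ≤ S
  span-≤ S a∈S (c , v≈) = resp S (λ t → sym (v≈ t)) (lincomb-∈ S c a∈S)

  basis-≤ : ∀ {d} {A : Subspace} {a : Fin d → V} (S : Subspace) → IsBasis A a → (∀ k → a k ∈ S) → A ≤ S
  basis-≤ S aBasis a∈S v∈A = span-≤ S a∈S (spans aBasis v∈A)

  ∈-span-tail : ∀ {d} {a : Fin (suc d) → V} {v} (p : v ∈ span a) → proj₁ p zero ≈ 0# → v ∈ span (a ∘ suc)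
  ∈-span-tail {a = a} (c , v≈) c₀≈0 = c ∘ suc , λ t → trans (v≈ t) (lincomb-head-zero c a c₀≈0 t)

  line : V → Subspace
  line u = span (λ (_ : Fin 1) → u)

  ∈-line : ∀ u → u ∈ line u
  ∈-line u = (λ _ → 1#) , λ t → sym (trans (+-identityʳ _) (*-identityˡ (u t)))

  line-≤ : ∀ {u} (S : Subspace) → u ∈ S → line u ≤ S
  line-≤ S u∈S = span-≤ S (λ _ → u∈S)

  line-basis : ∀ {u} → ¬ (u ≈v 0v) → IsBasis (line u) (λ _ → u)
  line-basis {u} u≉0 = record
    { inA      = λ _ → ∈-line u
    ; linIndep = λ c cu≈0 → λ { zero →
        ·-∈⇒≈0 (span {0} (λ ())) (u≉0 ∘ proj₂) ((λ ()) , λ t → trans (sym (+-identityʳ _)) (cu≈0 t)) }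
    ; spans    = λ u∈ → u∈
    }

  independent-∷ : ∀ {d} {u : V} {w : Fin d → V} → Independent w → ¬ (u ∈ span w) → Independent (u ∷ w)
  independent-∷ {u = u} {w} w-indep u∉ c lc≈0 = λ { zero → c₀≈0 ; (suc k) → w-indep (c ∘ suc) tail≈0 k }
    where
    c₀u∈ : (c zero · u) ∈ span w
    c₀u∈ = (λ k → - 1# * c (suc k)) , λ t → begin
      c zero * u t                         ≈⟨ inverseˡ-unique _ _ (lc≈0 t) ⟩
      - lincomb (c ∘ suc) w t              ≈⟨ -1*x≈-x _ ⟨
      - 1# * lincomb (c ∘ suc) w t         ≈⟨ lincomb-*ᶜ (- 1#) (c ∘ suc) w t ⟨
      lincomb (λ k → - 1# * c (suc k)) w t ∎
    c₀≈0 : c zero ≈ 0#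
    c₀≈0 = ·-∈⇒≈0 (span w) u∉ c₀u∈
    tail≈0 : lincomb (c ∘ suc) w ≈v 0v
    tail≈0 t = trans (sym (lincomb-head-zero c (u ∷ w) c₀≈0 t)) (lc≈0 t)

  independent-shift : ∀ {d} {b : Fin (suc d) → V} (i : Fin (suc d)) (μ : Fin d → Carrier) →
                      Independent b → Independent (λ k → b (punchIn i k) +v μ k · b i)
  independent-shift {b = b} i μ b-indep c lc≈0 j = begin
    c j              ≡⟨ insertAt-punchIn c i δ j ⟨
    c⁺ (punchIn i j) ≈⟨ b-indep c⁺ lc⁺≈0 (punchIn i j) ⟩
    0#               ∎
    where
    δ : Carrier
    δ = sum (λ k → c k * μ k)
    c⁺ : Fin _ → Carrier
    c⁺ = insertAt c i δ
    lc⁺≈0 : lincomb c⁺ b ≈v 0v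
    lc⁺≈0 t = begin
      lincomb c⁺ b t
        ≈⟨ lincomb-removeAt i c⁺ b t ⟩
      c⁺ i * b i t + lincomb (c⁺ ∘ punchIn i) (b ∘ punchIn i) t
        ≈⟨ +-cong (*-congʳ (reflexive (insertAt-lookup c i δ)))
                  (lincomb-cong (reflexive ∘ insertAt-punchIn c i δ) (λ _ _ → refl) t) ⟩
      δ * b i t + lincomb c (b ∘ punchIn i) t
        ≈⟨ lincomb-shift i μ c b t ⟨
      lincomb c (λ k → b (punchIn i k) +v μ k · b i) t
        ≈⟨ lc≈0 t ⟩
      0#
        ∎

  -- Exchange step: some b i₀ has a nonzero coefficient at a zero; subtracting multiples of b i₀
  -- from the other b's yields m independent vectors in the span of the remaining k a's.
  steinitz : ∀ {k m} (a : Fin k → V) (b : Fin m → V) → Independent b → (∀ i → b i ∈ span a) → m ℕ.≤ k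
  steinitz {zero}  {zero}  a b _ _ = ℕ.z≤n
  steinitz {zero}  {suc m} a b b-indep b∈ =
    contradiction (sym (b-indep (λ _ → 1#) (lincomb-zeroᵛ (λ _ → 1#) b (λ i → proj₂ (b∈ i))) zero)) 0≉1
  steinitz {suc k} {zero}  a b _ _ = ℕ.z≤n
  steinitz {suc k} {suc m} a b b-indep b∈ with all? (λ i → proj₁ (b∈ i) zero ≟ 0#)
  ... | yes heads≈0 =
    ℕ.m≤n⇒m≤1+n (steinitz (a ∘ suc) b b-indep (λ i → ∈-span-tail {a = a} (b∈ i) (heads≈0 i)))
  ... | no ¬heads≈0 with ¬∀⟶∃¬ _ _ (λ i → proj₁ (b∈ i) zero ≟ 0#) ¬heads≈0
  ...   | i₀ , p≉0 with inverse _ p≉0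
  ...     | y , py≈1 = ℕ.s≤s (steinitz (a ∘ suc) b' (independent-shift {b = b} i₀ μ b-indep) b'∈)
    where
    head : Fin (suc m) → Carrier
    head i = proj₁ (b∈ i) zero
    μ : Fin m → Carrier
    μ j = - (head (punchIn i₀ j) * y)
    b' : Fin m → V
    b' j = b (punchIn i₀ j) +v μ j · b i₀
    eliminated : ∀ l → l + - (l * y) * head i₀ ≈ 0#
    eliminated l = begin
      l + - (l * y) * head i₀   ≈⟨ +-congˡ (-‿distribˡ-* (l * y) (head i₀)) ⟨
      l + - (l * y * head i₀)   ≈⟨ +-congˡ (-‿cong (trans (*-assoc l y _) (*-congˡ (*-comm y _)))) ⟩
      l + - (l * (head i₀ * y)) ≈⟨ +-congˡ (-‿cong (trans (*-congˡ py≈1) (*-identityʳ l))) ⟩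
      l + - l                   ≈⟨ -‿inverseʳ l ⟩
      0#                        ∎
    b'∈ : ∀ j → b' j ∈ span (a ∘ suc)
    b'∈ j = ∈-span-tail {a = a} (+∈ (span a) (b∈ (punchIn i₀ j)) (·∈ (span a) (μ j) (b∈ i₀)))
                                (eliminated (head (punchIn i₀ j)))

  independent-length≤dim : ∀ {A : Subspace} {k m} {a : Fin k → V} {b : Fin m → V} →
                           IsBasis A a → Independent b → (∀ i → b i ∈ A) → m ℕ.≤ k
  independent-length≤dim {a = a} {b} aBasis b-indep b∈A = steinitz a b b-indep (spans aBasis ∘ b∈A)

  hyperplane-decompose : ∀ {A B : Subspace} {u} → IsHyperplaneOf B A → u ∈ A → ¬ (u ∈ B) →
                         ¬ ¬ (∀ {y} → y ∈ A → Σ Carrier λ l → (y +v (- l) · u) ∈ B)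
  hyperplane-decompose {A} {B} {u} (B≤A , d , (a , aBasis) , (b , bBasis)) u∈A u∉B =
    ¬¬-map (λ a∈ {y} y∈A → decompose (basis-≤ (span (u ∷ b)) aBasis a∈ y∈A))
           (¬¬-Π λ j → ¬¬-∈ (inA aBasis j))
    where
    u∉span : ¬ (u ∈ span b)
    u∉span = u∉B ∘ span-≤ B (inA bBasis)
    ¬¬-∈ : ∀ {y} → y ∈ A → ¬ ¬ (y ∈ span (u ∷ b))
    ¬¬-∈ {y} y∈A y∉ = ℕ.<-irrefl ≡.refl (independent-length≤dim aBasis y∷u∷b-indep y∷u∷b∈A)
      where
      y∷u∷b-indep : Independent (y ∷ u ∷ b)
      y∷u∷b-indep = independent-∷ {w = u ∷ b} (independent-∷ {w = b} (linIndep bBasis) u∉span) y∉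
      y∷u∷b∈A : ∀ i → (y ∷ u ∷ b) i ∈ A
      y∷u∷b∈A zero          = y∈A
      y∷u∷b∈A (suc zero)    = u∈A
      y∷u∷b∈A (suc (suc j)) = B≤A (inA bBasis j)
    decompose : ∀ {y} → y ∈ span (u ∷ b) → Σ Carrier λ l → (y +v (- l) · u) ∈ B
    decompose {y} (c , y≈) = c zero , resp B tail≈ (lincomb-∈ B (c ∘ suc) (inA bBasis))
      where
      tail≈ : lincomb (c ∘ suc) b ≈v y +v (- c zero) · u
      tail≈ t = begin
        lincomb (c ∘ suc) b t
          ≈⟨ xyx⁻¹≈y (c zero * u t) _ ⟨
        (c zero * u t + lincomb (c ∘ suc) b t) + - (c zero * u t)
          ≈⟨ +-cong (y≈ t) (sym (-‿distribˡ-* (c zero) (u t))) ⟨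
        y t + - c zero * u t
          ∎

  [py+l]-[qy+l]≈[p-q]y : ∀ {x z p q y l} → x ≈ p * y + l → z ≈ q * y + l → x + - z ≈ (p + - q) * y
  [py+l]-[qy+l]≈[p-q]y {x} {z} {p} {q} {y} {l} x≈ z≈ = begin
    x + - z                         ≈⟨ +-cong x≈ (-‿cong z≈) ⟩
    (p * y + l) + - (q * y + l)     ≈⟨ +-congˡ (⁻¹-∙-comm (q * y) l) ⟨
    (p * y + l) + (- (q * y) + - l) ≈⟨ interchange (p * y) l (- (q * y)) (- l) ⟩
    (p * y + - (q * y)) + (l + - l) ≈⟨ +-cong (+-congˡ (-‿distribˡ-* q y)) (-‿inverseʳ l) ⟩
    (p * y + - q * y) + 0#          ≈⟨ +-identityʳ _ ⟩
    p * y + - q * y                 ≈⟨ distribʳ y p (- q) ⟨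
    (p + - q) * y                   ∎

  intersection-basis : ∀ {x} {B X : Subspace} {b : Fin (suc x) → V} → IsBasis X b → (i : Fin (suc x)) →
                       ¬ (b i ∈ B) → (l : Fin (suc x) → Carrier) → (∀ j → (b j +v (- l j) · b i) ∈ B) →
                       HasDim (B ∩ X) x
  intersection-basis {x} {B} {X} {b} bBasis i bᵢ∉B l shifted∈B =
    β , record { inA = β∈ ; linIndep = independent-shift {b = b} i μ (linIndep bBasis) ; spans = β-spans }
    where
    μ : Fin x → Carrier
    μ k = - l (punchIn i k)
    β : Fin x → V
    β k = b (punchIn i k) +v μ k · b i
    β∈ : ∀ k → β k ∈ (B ∩ X)
    β∈ k = shifted∈B (punchIn i k) , +∈ X (inA bBasis (punchIn i k)) (·∈ X (μ k) (inA bBasis i))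
    β-spans : ∀ {u} → u ∈ (B ∩ X) → Σ (Fin x → Carrier) λ c → u ≈v lincomb c β
    β-spans {u} (u∈B , u∈X) =
      e' , λ t → x∙y⁻¹≈ε⇒x≈y _ _ (trans (difference t) (trans (*-congʳ κ≈0) (zeroˡ _)))
      where
      e : Fin (suc x) → Carrier
      e = proj₁ (spans bBasis u∈X)
      e' : Fin x → Carrier
      e' = e ∘ punchIn i
      κ : Carrier
      κ = e i + - sum (λ k → e' k * μ k)
      difference : ∀ t → u t + - lincomb e' β t ≈ κ * b i t
      difference t = [py+l]-[qy+l]≈[p-q]y (trans (proj₂ (spans bBasis u∈X) t) (lincomb-removeAt i e b t))
                                           (lincomb-shift i μ e' b t)
      -- κ · b i = u − Σ e' β lies in B although b i does not.
      κ≈0 : κ ≈ 0#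
      κ≈0 = ·-∈⇒≈0 B bᵢ∉B (resp B (λ t → trans (+-congˡ (-1*x≈-x _)) (difference t))
                                  (+∈ B u∈B (·∈ B (- 1#) (lincomb-∈ B e' (proj₁ ∘ β∈)))))

module QMatroidRank (F : FiniteField) (n : ℕ) (_≟_ : Decidable (FiniteField._≈_ F))
                    (M : Space.QMatroid F n) where
  open FiniteField F hiding (zero)
  open Space F n
  open QMatroid M
  open IsBasis using (inA; linIndep; spans)
  open LinearAlgebra F n _≟_
  open IntegerArithmetic

  r-cong : ∀ {X Y} → X ≤ Y → Y ≤ X → r X ≡ r Y
  r-cong X≤Y Y≤X = r-ext ((λ {v} → X≤Y {v}) , (λ {v} → Y≤X {v}))

  r-subadditive : ∀ X Y → r (X ⊕ Y) ℤ.≤ r X ℤ.+ r Y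
  r-subadditive X Y = begin
    r (X ⊕ Y)                       ≡⟨ ℤ.+-identityʳ _ ⟨
    r (X ⊕ Y) ℤ.+ + 0               ≤⟨ ℤ.+-monoʳ-≤ (r (X ⊕ Y)) (R1-lower (X ∩ Y)) ⟩
    r (X ⊕ Y) ℤ.+ r (X ∩ Y)         ≤⟨ R3 X Y ⟩
    r X ℤ.+ r Y                     ∎
    where open ℤ.≤-Reasoning

  r-line≤1 : ∀ {u} → ¬ (u ≈v 0v) → r (line u) ℤ.≤ + 1
  r-line≤1 u≉0 = R1-upper (line _) 1 (_ , line-basis u≉0)

  r-span-∷ : ∀ {d} {u} (w : Fin d → V) → ¬ (u ≈v 0v) → r (span (u ∷ w)) ℤ.≤ + 1 ℤ.+ r (span w)
  r-span-∷ {u = u} w u≉0 = begin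
    r (span (u ∷ w))           ≤⟨ R2 split ⟩
    r (line u ⊕ span w)        ≤⟨ r-subadditive (line u) (span w) ⟩
    r (line u) ℤ.+ r (span w)  ≤⟨ ℤ.+-monoˡ-≤ (r (span w)) (r-line≤1 u≉0) ⟩
    + 1 ℤ.+ r (span w)         ∎
    where
    open ℤ.≤-Reasoning
    split : span (u ∷ w) ≤ (line u ⊕ span w)
    split (c , v≈) = c zero · u , lincomb (c ∘ suc) w ,
                     ((λ _ → c zero) , λ t → sym (+-identityʳ _)) , (c ∘ suc , λ t → refl) , v≈

  rank-gap≤dim-gap-span : ∀ {A dA} {a : Fin dA → V} → IsBasis A a → ∀ k {s} (w : Fin s → V) → s ℕ.+ k ≡ dA →
                          Independent w → (∀ i → w i ∈ A) → r A ℤ.+ + s ℤ.≤ r (span w) ℤ.+ + dA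
  rank-gap≤dim-gap-span {A} {dA} {a} aBasis k {s} w s+k≡dA w-indep w∈A =
    decidable-stable (_ ℤ.≤? _) (¬¬-map extend (¬¬-∀⊎∃¬ (λ j → a j ∈ span w)))
    where
    extend : (∀ j → a j ∈ span w) ⊎ (∃ λ j → ¬ (a j ∈ span w)) → r A ℤ.+ + s ℤ.≤ r (span w) ℤ.+ + dA
    extend (inj₁ a∈) = ℤ.+-mono-≤ (ℤ.≤-reflexive (r-cong (basis-≤ (span w) aBasis a∈) (span-≤ A w∈A)))
                                   (ℤ.+≤+ (≡.subst (s ℕ.≤_) s+k≡dA (ℕ.m≤m+n s k)))
    extend (inj₂ (j , aⱼ∉)) = grow k s+k≡dA
      where
      w' : Fin (suc s) → V
      w' = a j ∷ w
      w'-indep : Independent w'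
      w'-indep = independent-∷ {w = w} w-indep aⱼ∉
      w'∈A : ∀ i → w' i ∈ A
      w'∈A zero    = inA aBasis j
      w'∈A (suc i) = w∈A i
      grow : ∀ k → s ℕ.+ k ≡ dA → r A ℤ.+ + s ℤ.≤ r (span w) ℤ.+ + dA
      grow zero    s+0≡dA = contradiction (independent-length≤dim aBasis w'-indep w'∈A)
                                          (ℕ.<-irrefl (≡.trans (≡.sym (ℕ.+-identityʳ s)) s+0≡dA))
      grow (suc k) s+k≡dA = +1-cancel-≤ (r A) (+ s) (r (span w)) (+ dA) (ℤ.≤-trans
        (rank-gap≤dim-gap-span aBasis k w' (≡.trans (≡.sym (ℕ.+-suc s k)) s+k≡dA) w'-indep w'∈A)
        (ℤ.+-monoˡ-≤ (+ dA) (r-span-∷ w (∉⇒≉0 {span w} aⱼ∉))))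

  rank-gap≤dim-gap : ∀ {A C dA dC} {a : Fin dA → V} {c : Fin dC → V} → IsBasis A a → IsBasis C c → C ≤ A →
                     r A ℤ.+ + dC ℤ.≤ r C ℤ.+ + dA
  rank-gap≤dim-gap {A} {C} {dA} {dC} {a} {c} aBasis cBasis C≤A = begin
    r A ℤ.+ + dC
      ≤⟨ rank-gap≤dim-gap-span aBasis (dA ℕ.∸ dC) c (ℕ.m+[n∸m]≡n dC≤dA) (linIndep cBasis) c∈A ⟩
    r (span c) ℤ.+ + dA
      ≡⟨ ≡.cong (ℤ._+ + dA) (r-cong (span-≤ C (inA cBasis)) (spans cBasis)) ⟩
    r C ℤ.+ + dA
      ∎
    where
    open ℤ.≤-Reasoning
    c∈A : ∀ i → c i ∈ A
    c∈A = C≤A ∘ inA cBasis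
    dC≤dA : dC ℕ.≤ dA
    dC≤dA = independent-length≤dim aBasis (linIndep cBasis) c∈A

  r-hyperplane-⊕ : ∀ {A B : Subspace} {u} → IsHyperplaneOf B A →
                   (Y : Subspace) → Y ≤ A → u ∈ Y → ¬ (u ∈ B) → r (B ⊕ Y) ≡ r A
  r-hyperplane-⊕ {A} {B} {u} hyp@(B≤A , _) Y Y≤A u∈Y u∉B = decidable-stable (_ ℤ.≟ _)
    (¬¬-map (λ decompose → r-cong (⊕-≤ {B} {Y} {A} B≤A Y≤A) (λ y∈A → split (decompose y∈A)))
            (hyperplane-decompose hyp (Y≤A u∈Y) u∉B))
    where
    open import Relation.Binary.Reasoning.Setoid setoid
    split : ∀ {y} → Σ Carrier (λ l → (y +v (- l) · u) ∈ B) → y ∈ (B ⊕ Y)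
    split {y} (l , y-lu∈B) = y +v (- l) · u , l · u , y-lu∈B , ·∈ Y l u∈Y , λ t → begin
      y t                         ≈⟨ +-identityʳ (y t) ⟨
      y t + 0#                    ≈⟨ +-congˡ (trans (*-congʳ (-‿inverseˡ l)) (zeroˡ (u t))) ⟨
      y t + (- l + l) * u t       ≈⟨ +-congˡ (distribʳ (u t) (- l) l) ⟩
      y t + (- l * u t + l * u t) ≈⟨ +-assoc (y t) _ _ ⟨
      (y t + - l * u t) + l * u t ∎

module CyclicSpace (F : FiniteField) (n : ℕ) (_≟_ : Decidable (FiniteField._≈_ F)) (M : Space.QMatroid F n)
                   {A C : Space.Subspace F n} (cyc : Space.IsCyc F n M A C) where
  open FiniteField F hiding (zero)
  open Space F n
  open QMatroid M
  open IsBasis using (inA; linIndep)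
  open LinearAlgebra F n _≟_
  open QMatroidRank F n _≟_ M
  open IntegerArithmetic
  open RawMonad (¬¬-Monad {0ℓ})

  cyc≤ : C ≤ A
  cyc≤ v∈C with proj₁ cyc v∈C
  ... | _ , _ , w , cyclic , w∈ , v≈ =
    resp A (λ t → sym (v≈ t)) (vsum-∈ A (λ i → proj₁ (proj₂ (cyclic i)) (w∈ i)))

  cyclic-line⇒∈cyc : ∀ {v} → v ∈ A → ¬ (v ≈v 0v) →
                     (∀ B → IsHyperplaneOf B A → r (B ⊕ line v) ≡ r B) → v ∈ C
  cyclic-line⇒∈cyc {v} v∈A v≉0 cyclic = proj₂ cyc
    (1 , (λ _ → line v) , (λ _ → v) , (λ _ → (_ , line-basis v≉0) , line-≤ A v∈A , cyclic) ,
     (λ _ → ∈-line v) , λ t → sym (+-identityʳ (v t)))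

  separating-hyperplane : ∀ {v} → v ∈ A → ¬ (v ∈ C) →
                          ¬ ¬ (Σ Subspace λ B → IsHyperplaneOf B A × ¬ (v ∈ B) × r B ℤ.< r A)
  separating-hyperplane {v} v∈A v∉C ¬separated = v∉C (cyclic-line⇒∈cyc v∈A (∉⇒≉0 {C} v∉C) λ B hyp →
    decidable-stable (_ ℤ.≟ _) λ ne → ¬separated (B , hyp , v∉ B ne , r<r B hyp ne))
    where
    v∉ : ∀ B → ¬ (r (B ⊕ line v) ≡ r B) → ¬ (v ∈ B)
    v∉ B ne v∈B = ne (r-cong (⊕-≤ {B} {line v} {B} (λ p → p) (line-≤ B v∈B))
                             (λ p → _ , 0v , p , 0∈ (line v) , λ t → sym (+-identityʳ _)))
    r<r : ∀ B → IsHyperplaneOf B A → ¬ (r (B ⊕ line v) ≡ r B) → r B ℤ.< r A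
    r<r B hyp@(B≤A , _) ne = ℤ.≤∧≢⇒< (R2 B≤A) λ rB≡rA →
      ne (≡.trans (r-hyperplane-⊕ hyp (line v) (line-≤ A v∈A) (∈-line v) (v∉ B ne)) (≡.sym rB≡rA))

  cyclic-line⊆hyperplane : ∀ {B x w} → IsHyperplaneOf B A → r B ℤ.< r A →
                           IsCycLine M A x → w ∈ x → ¬ ¬ (w ∈ B)
  cyclic-line⊆hyperplane {B} {x} hyp rB<rA (_ , x≤A , cyclic) w∈x w∉B =
    ℤ.<⇒≢ rB<rA (≡.trans (≡.sym (cyclic B hyp)) (r-hyperplane-⊕ hyp x x≤A w∈x w∉B))

  cyc≤hyperplane : ∀ {B dC} {c : Fin dC → V} → IsHyperplaneOf B A → r B ℤ.< r A → IsBasis C c → ¬ ¬ (C ≤ B)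
  cyc≤hyperplane {B} hyp rB<rA cBasis = ¬¬-map (basis-≤ B cBasis) (¬¬-Π λ j → ¬¬-∈B (inA cBasis j))
    where
    ¬¬-∈B : ∀ {v} → v ∈ C → ¬ ¬ (v ∈ B)
    ¬¬-∈B v∈C with proj₁ cyc v∈C
    ... | _ , _ , w , cyclic , w∈ , v≈ =
      ¬¬-map (λ w∈B → resp B (λ t → sym (v≈ t)) (vsum-∈ B w∈B))
             (¬¬-Π λ i → cyclic-line⊆hyperplane hyp rB<rA (cyclic i) (w∈ i))

  module _ {dC} {c : Fin dC → V} (cBasis : IsBasis C c) where
    dim-gap≤rank-gap : ∀ m {X} → HasDim X m → C ≤ X → X ≤ A → r C ℤ.+ + m ℤ.≤ r X ℤ.+ + dC
    dim-gap≤rank-gap zero _ C≤X _ = ℤ.+-mono-≤ (R2 C≤X) (ℤ.+≤+ ℕ.z≤n)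
    dim-gap≤rank-gap (suc m) {X} (b , bBasis) C≤X X≤A =
      decidable-stable (_ ℤ.≤? _) (¬¬-∀⊎∃¬ (λ i → b i ∈ C) >>= cases)
      where
      goal : Set
      goal = r C ℤ.+ + suc m ℤ.≤ r X ℤ.+ + dC
      cases : (∀ i → b i ∈ C) ⊎ (∃ λ i → ¬ (b i ∈ C)) → ¬ ¬ goal
      cases (inj₁ b∈C) =
        pure (ℤ.+-mono-≤ (R2 C≤X) (ℤ.+≤+ (independent-length≤dim cBasis (linIndep bBasis) b∈C)))
      cases (inj₂ (i , bᵢ∉C)) ¬goal =
        separating-hyperplane bᵢ∈A bᵢ∉C λ (B , hyp , bᵢ∉B , rB<rA) → descend B hyp bᵢ∉B rB<rA ¬goal
        where
        bᵢ∈A : b i ∈ A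
        bᵢ∈A = X≤A (inA bBasis i)
        descend : ∀ B → IsHyperplaneOf B A → ¬ (b i ∈ B) → r B ℤ.< r A → ¬ ¬ goal
        descend B hyp bᵢ∉B rB<rA = do
          C≤B ← cyc≤hyperplane hyp rB<rA cBasis
          decompose ← hyperplane-decompose hyp bᵢ∈A bᵢ∉B
          let B∩X-dim = intersection-basis bBasis i bᵢ∉B (λ j → proj₁ (decompose (X≤A (inA bBasis j))))
                                                         (λ j → proj₂ (decompose (X≤A (inA bBasis j))))
              IH      = dim-gap≤rank-gap m B∩X-dim (λ p → C≤B p , C≤X p) (X≤A ∘ proj₂)
          pure (i+m≤j+d∧j<k⇒i+suc[m]≤k+d {r C} m dC IH (i+j≤k+l∧k<i⇒j<l submodular rB<rA))
          where
          submodular : r A ℤ.+ r (B ∩ X) ℤ.≤ r B ℤ.+ r X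
          submodular = ≡.subst (λ z → z ℤ.+ r (B ∩ X) ℤ.≤ r B ℤ.+ r X)
                               (r-hyperplane-⊕ hyp X X≤A (inA bBasis i) bᵢ∉B) (R3 B X)

  rank-gap≡dim-gap : ∀ {dA dC} → HasDim A dA → HasDim C dC → r A ℤ.+ + dC ≡ r C ℤ.+ + dA
  rank-gap≡dim-gap {dA} A-dim@(a , aBasis) (c , cBasis) =
    ℤ.≤-antisym (rank-gap≤dim-gap aBasis cBasis cyc≤) (dim-gap≤rank-gap cBasis dA A-dim cyc≤ (λ p → p))

proposition2p18 : (F : FiniteField) (n : ℕ) (M : Space.QMatroid F n)
    (A C : Space.Subspace F n) → Space.IsCyc F n M A C →
    (dA dC : ℕ) → Space.HasDim F n A dA → Space.HasDim F n C dC →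
    Space.QMatroid.r M A - Space.QMatroid.r M C ≡ + dA - + dC
proposition2p18 F n M A C cyc dA dC A-dim C-dim = decidable-stable (_ ℤ.≟ _) (¬¬-map
  (λ _≟_ → IntegerArithmetic.i+l≡k+j⇒i-k≡j-l (r A) (+ dA) (r C) (+ dC)
             (CyclicSpace.rank-gap≡dim-gap F n _≟_ M cyc A-dim C-dim))
  (¬¬-≈-decidable F))
  where open Space.QMatroid M using (r)
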